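{- Let $n$ and $d$ be positive integers with $\gcd(n,d)=1$, let $r$ be an integer with $\gcd(r,d)=1$, and let $m$ be the least nonnegative residue of $-r/d$ modulo $n$ (so $0\le m\le n-1$ and $md\equiv -r\pmod n$). Write $$ \frac{(q^r;q^d)_m(q^{r+(m+1)d};q^d)_m}{(q^d;q^d)_m^2}=\frac{A(q)}{B(q)}, $$ where $A(q)$ and $B(q)$ are relatively prime polynomials in $q$. Then $B(q)$ is relatively prime to $1-q^n$.
   Context: $(b;q)_0=1$ and $(b;q)_k=(1-b)(1-bq)\cdots(1-bq^{k-1})$ for $k\ge1$. -}

module Defs where

open import Data.Nat as ℕ using (ℕ; zero; suc)
open import Data.Integer as ℤ using (ℤ; +_; -[1+_])
open import Data.List using (List; []; _∷_; replicate; _++_)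
open import Data.List.Relation.Unary.All using (All)
open import Data.Product using (Σ; _×_; _,_)
open import Relation.Binary.PropositionalEquality using (_≡_)

-- Polynomials in q with integer coefficients, as coefficient lists:
-- the i-th entry is the coefficient of q^i (trailing zeros allowed).
Poly : Set
Poly = List ℤ

infixl 6 _+P_ _-P_
infixl 7 _*P_ _·P_

_+P_ : Poly → Poly → Poly
[] +P q = q
(a ∷ p) +P [] = a ∷ p
(a ∷ p) +P (b ∷ q) = (a ℤ.+ b) ∷ (p +P q)

-P_ : Poly → Poly
-P [] = []
-P (a ∷ p) = ℤ.- a ∷ (-P p)

_-P_ : Poly → Poly → Poly
p -P q = p +P (-P q)

_·P_ : ℤ → Poly → Poly
c ·P [] = []
c ·P (a ∷ p) = (c ℤ.* a) ∷ (c ·P p)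

_*P_ : Poly → Poly → Poly
[] *P q = []
(a ∷ p) *P q = (a ·P q) +P (ℤ.0ℤ ∷ (p *P q))

oneP : Poly
oneP = ℤ.1ℤ ∷ []

qpow : ℕ → Poly
qpow k = replicate k ℤ.0ℤ ++ (ℤ.1ℤ ∷ [])

-- semantic equality of polynomials (coefficientwise, up to trailing zeros)
IsZeroP : Poly → Set
IsZeroP p = All (_≡ ℤ.0ℤ) p

infix 4 _≈P_ _∣P_
_≈P_ : Poly → Poly → Set
p ≈P q = IsZeroP (p -P q)

_∣P_ : Poly → Poly → Set
a ∣P b = Σ Poly (λ c → c *P a ≈P b)

CoprimeP : Poly → Poly → Set
CoprimeP a b = (c : Poly) → c ∣P a → c ∣P b → c ∣P oneP

-- A rational function in q, represented as (numerator , denominator).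
RatF : Set
RatF = Poly × Poly

_*R_ : RatF → RatF → RatF
(a , b) *R (c , d) = (a *P c , b *P d)

oneR : RatF
oneR = (oneP , oneP)

-- the factor 1 - q^e for an integer exponent e, as a rational function:
--   e = k ≥ 0 :  (1 - q^k) / 1
--   e = -(k+1):  1 - q^{-(k+1)} = (q^{k+1} - 1) / q^{k+1}
oneMinusQ : ℤ → RatF
oneMinusQ (+ k) = (oneP -P qpow k , oneP)
oneMinusQ -[1+ k ] = (qpow (suc k) -P oneP , qpow (suc k))

poch : ℤ → ℤ → ℕ → RatF
poch a d zero = oneR
poch a d (suc m) = poch a d m *R oneMinusQ (a ℤ.+ (+ m) ℤ.* d)

infix 4 _≡R_
_≡R_ : RatF → RatF → Set
(a , b) ≡R (c , d) = a *P d ≈P b *P c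

_/R_ : RatF → RatF → RatF
(a , b) /R (c , d) = (a *P d , b *P c)

-- Put N = md + r, a_j = (j+1)d and g_j = gcd(a_j, n), so that g_j ∣ n ∣ N.  Each factor
-- 1 - q^{a_j} of (q^d;q^d)_m splits as (1 - q^{g_j}) [k_j]_{q^{g_j}} with k_j = a_j/g_j, while
-- the numerator factors 1 - q^{N - a_{m-1-j}} of (q^r;q^d)_m and 1 - q^{N + a_j} of
-- (q^{r+(m+1)d};q^d)_m are divisible by 1 - q^{g_{m-1-j}} and 1 - q^{g_j} respectively.
-- Cancelling ∏(1 - q^{g_j})², whose constant term is 1, gives B ∣ A·G, where G collects the
-- q-integers [k_j]_{q^{g_j}} and the powers of q that are the denominators of the factors
-- with negative exponent.  All of these are coprime to 1 - q^n over ℚ; for [k]_w and 1 - w^h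
-- with gcd(k, h) = 1, the ideal they generate contains 1 - w^k and 1 - w^h, hence 1 - w,
-- and so k, as [k]_w ≡ k mod 1 - w.  So some integer M ≠ 0 lies in the ideal (G, 1 - q^n); a
-- common divisor of B and 1 - q^n divides M·A; since 1 - q^n has constant term 1 the integer
-- M can be divided out, so the divisor divides A and is a unit.

module Submission where

open import Defs
open import Data.Nat as ℕ using (ℕ; _<_)
open import Data.Nat.GCD as NG using ()
open import Data.Integer as ℤ using (ℤ; +_)
open import Data.Integer.GCD as IG using ()
open import Data.Integer.Divisibility as ID using ()
open import Data.Product using (_,_)
open import Relation.Binary.PropositionalEquality using (_≡_)

open import Data.Nat using (zero; suc; _∸_)
import Data.Nat.Properties as ℕₚ
open import Data.Nat.Divisibility using (divides) renaming (_∣_ to _∣ℕ_)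
open import Data.Nat.DivMod using (_/_; m*[n/m]≡n)
open NG using (module Bézout)
open import Data.Nat.Coprimality using (coprime-Bézout; coprime-/gcd)
open import Data.Integer using (0ℤ; 1ℤ; -[1+_])
import Data.Integer.Properties as ℤₚ
open import Data.Integer.Divisibility.Signed
  using ( divides; quotient; ∣⇒∣ᵤ; ∣ᵤ⇒∣; 0∣⇒≡0
        ; ∣m⇒∣m*n; ∣m+n∣m⇒∣n; ∣m∣n⇒∣m+n; ∣m∣n⇒∣m-n)
  renaming (_∣_ to _∣ℤ_; ∣-trans to ℤ∣-trans)
open import Data.Integer.Tactic.RingSolver as ℤ-Solver using ()
open import Data.List using ([]; _∷_)
open import Data.List.Relation.Unary.All using ([]; _∷_)
open import Data.Maybe using (Maybe; just; nothing)
open import Data.Product using (Σ-syntax; _×_; proj₁; proj₂)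
open import Data.Sum using (inj₂)
open import Function using (_∘_)
open import Relation.Nullary using (yes)
open import Relation.Binary.Bundles using (Setoid)
open import Relation.Binary.Structures using (IsEquivalence)
open import Relation.Binary.PropositionalEquality
  using (refl; sym; trans; cong; cong₂; subst; module ≡-Reasoning)
import Relation.Binary.Reasoning.Setoid as SetoidReasoning
open import Algebra.Bundles using (CommutativeRing)
open import Tactic.RingSolver using (solve-∀)
open import Tactic.RingSolver.Core.AlmostCommutativeRing
  using (AlmostCommutativeRing; fromCommutativeRing)

-- The ring ℤ[q]

coeff : Poly → ℕ → ℤ
coeff [] i = 0ℤ
coeff (a ∷ p) zero = a
coeff (a ∷ p) (suc i) = coeff p i

infix 4 _≋_
record _≋_ (p q : Poly) : Set where
  constructor mk≋
  field coeff-≡ : ∀ i → coeff p i ≡ coeff q i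
open _≋_

≋-refl : ∀ {p} → p ≋ p
≋-refl = mk≋ λ i → refl

≋-sym : ∀ {p q} → p ≋ q → q ≋ p
≋-sym (mk≋ e) = mk≋ λ i → sym (e i)

≋-trans : ∀ {p q r} → p ≋ q → q ≋ r → p ≋ r
≋-trans (mk≋ e) (mk≋ f) = mk≋ λ i → trans (e i) (f i)

≋-reflexive : ∀ {p q} → p ≡ q → p ≋ q
≋-reflexive refl = ≋-refl

≋-isEquivalence : IsEquivalence _≋_
≋-isEquivalence = record { refl = ≋-refl ; sym = ≋-sym ; trans = ≋-trans }

≋-setoid : Setoid _ _
≋-setoid = record { isEquivalence = ≋-isEquivalence }

module ≋-Reasoning = SetoidReasoning ≋-setoid

∷-cong : ∀ {a b p q} → a ≡ b → p ≋ q → a ∷ p ≋ b ∷ q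
∷-cong a≡b p≋q = mk≋ λ { zero → a≡b ; (suc i) → coeff-≡ p≋q i }

0∷[]≋[] : 0ℤ ∷ [] ≋ []
0∷[]≋[] = mk≋ λ { zero → refl ; (suc i) → refl }

coeff-+ : ∀ p q i → coeff (p +P q) i ≡ coeff p i ℤ.+ coeff q i
coeff-+ [] q i = sym (ℤₚ.+-identityˡ _)
coeff-+ (a ∷ p) [] i = sym (ℤₚ.+-identityʳ _)
coeff-+ (a ∷ p) (b ∷ q) zero = refl
coeff-+ (a ∷ p) (b ∷ q) (suc i) = coeff-+ p q i

coeff-neg : ∀ p i → coeff (-P p) i ≡ ℤ.- coeff p i
coeff-neg [] i = refl
coeff-neg (a ∷ p) zero = refl
coeff-neg (a ∷ p) (suc i) = coeff-neg p i

coeff-scale : ∀ a p i → coeff (a ·P p) i ≡ a ℤ.* coeff p i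
coeff-scale a [] i = sym (ℤₚ.*-zeroʳ a)
coeff-scale a (b ∷ p) zero = refl
coeff-scale a (b ∷ p) (suc i) = coeff-scale a p i

coeff-*-∷ : ∀ a p q i → coeff ((a ∷ p) *P q) i ≡ a ℤ.* coeff q i ℤ.+ coeff (0ℤ ∷ p *P q) i
coeff-*-∷ a p q i = trans (coeff-+ (a ·P q) (0ℤ ∷ p *P q) i) (cong (ℤ._+ _) (coeff-scale a q i))

+-cong : ∀ {p p′ q q′} → p ≋ p′ → q ≋ q′ → p +P q ≋ p′ +P q′
+-cong {p} {p′} {q} {q′} (mk≋ e) (mk≋ f) = mk≋ λ i →
  trans (coeff-+ p q i) (trans (cong₂ ℤ._+_ (e i) (f i)) (sym (coeff-+ p′ q′ i)))

neg-cong : ∀ {p p′} → p ≋ p′ → -P p ≋ -P p′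
neg-cong {p} {p′} (mk≋ e) = mk≋ λ i →
  trans (coeff-neg p i) (trans (cong ℤ.-_ (e i)) (sym (coeff-neg p′ i)))

scale-cong : ∀ a {p p′} → p ≋ p′ → a ·P p ≋ a ·P p′
scale-cong a {p} {p′} (mk≋ e) = mk≋ λ i →
  trans (coeff-scale a p i) (trans (cong (a ℤ.*_) (e i)) (sym (coeff-scale a p′ i)))

+-assoc : ∀ p q r → (p +P q) +P r ≋ p +P (q +P r)
+-assoc p q r = mk≋ λ i → begin
  coeff ((p +P q) +P r) i
    ≡⟨ trans (coeff-+ (p +P q) r i) (cong (ℤ._+ _) (coeff-+ p q i)) ⟩
  coeff p i ℤ.+ coeff q i ℤ.+ coeff r i
    ≡⟨ ℤₚ.+-assoc (coeff p i) _ _ ⟩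
  coeff p i ℤ.+ (coeff q i ℤ.+ coeff r i)
    ≡⟨ sym (trans (coeff-+ p (q +P r) i) (cong (ℤ._+_ (coeff p i)) (coeff-+ q r i))) ⟩
  coeff (p +P (q +P r)) i ∎
  where open ≡-Reasoning

+-comm : ∀ p q → p +P q ≋ q +P p
+-comm p q = mk≋ λ i →
  trans (coeff-+ p q i) (trans (ℤₚ.+-comm (coeff p i) _) (sym (coeff-+ q p i)))

+-identityʳ : ∀ p → p +P [] ≋ p
+-identityʳ p = mk≋ λ i → trans (coeff-+ p [] i) (ℤₚ.+-identityʳ _)

+-interchange : ∀ p q r s → (p +P q) +P (r +P s) ≋ (p +P r) +P (q +P s)
+-interchange p q r s = mk≋ λ i → begin
  coeff ((p +P q) +P (r +P s)) i
    ≡⟨ trans (coeff-+ (p +P q) (r +P s) i) (cong₂ ℤ._+_ (coeff-+ p q i) (coeff-+ r s i)) ⟩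
  (coeff p i ℤ.+ coeff q i) ℤ.+ (coeff r i ℤ.+ coeff s i)
    ≡⟨ interchange (coeff p i) (coeff q i) (coeff r i) (coeff s i) ⟩
  (coeff p i ℤ.+ coeff r i) ℤ.+ (coeff q i ℤ.+ coeff s i)
    ≡⟨ sym (trans (coeff-+ (p +P r) (q +P s) i) (cong₂ ℤ._+_ (coeff-+ p r i) (coeff-+ q s i))) ⟩
  coeff ((p +P r) +P (q +P s)) i ∎
  where
  open ≡-Reasoning
  open import Algebra.Properties.CommutativeSemigroup ℤₚ.+-commutativeSemigroup
    using (interchange)

-‿inverseʳ : ∀ p → p +P (-P p) ≋ []
-‿inverseʳ p = mk≋ λ i → trans (coeff-+ p (-P p) i)
  (trans (cong (ℤ._+_ (coeff p i)) (coeff-neg p i)) (ℤₚ.+-inverseʳ (coeff p i)))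

-‿inverseˡ : ∀ p → (-P p) +P p ≋ []
-‿inverseˡ p = ≋-trans (+-comm (-P p) p) (-‿inverseʳ p)

scale-distrib : ∀ a p q → a ·P (p +P q) ≋ a ·P p +P a ·P q
scale-distrib a p q = mk≋ λ i → begin
  coeff (a ·P (p +P q)) i
    ≡⟨ trans (coeff-scale a (p +P q) i) (cong (a ℤ.*_) (coeff-+ p q i)) ⟩
  a ℤ.* (coeff p i ℤ.+ coeff q i)
    ≡⟨ ℤₚ.*-distribˡ-+ a (coeff p i) (coeff q i) ⟩
  a ℤ.* coeff p i ℤ.+ a ℤ.* coeff q i
    ≡⟨ sym (trans (coeff-+ (a ·P p) (a ·P q) i) (cong₂ ℤ._+_ (coeff-scale a p i) (coeff-scale a q i))) ⟩
  coeff (a ·P p +P a ·P q) i ∎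
  where open ≡-Reasoning

scale-zero : ∀ p → 0ℤ ·P p ≋ []
scale-zero p = mk≋ λ i → coeff-scale 0ℤ p i

scale-one : ∀ p → 1ℤ ·P p ≋ p
scale-one p = mk≋ λ i → trans (coeff-scale 1ℤ p i) (ℤₚ.*-identityˡ (coeff p i))

scale-scale : ∀ a b p → (a ℤ.* b) ·P p ≋ a ·P (b ·P p)
scale-scale a b p = mk≋ λ i → begin
  coeff ((a ℤ.* b) ·P p) i   ≡⟨ coeff-scale (a ℤ.* b) p i ⟩
  a ℤ.* b ℤ.* coeff p i      ≡⟨ ℤₚ.*-assoc a b (coeff p i) ⟩
  a ℤ.* (b ℤ.* coeff p i)
    ≡⟨ sym (trans (coeff-scale a (b ·P p) i) (cong (a ℤ.*_) (coeff-scale b p i))) ⟩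
  coeff (a ·P (b ·P p)) i    ∎
  where open ≡-Reasoning

0∷-scale : ∀ a p → 0ℤ ∷ a ·P p ≋ a ·P (0ℤ ∷ p)
0∷-scale a p = ∷-cong (sym (ℤₚ.*-zeroʳ a)) ≋-refl

*-zeroʳ : ∀ p → p *P [] ≋ []
*-zeroʳ [] = ≋-refl
*-zeroʳ (a ∷ p) = mk≋ λ { zero → refl ; (suc i) → coeff-≡ (*-zeroʳ p) i }

*-congˡ : ∀ p {q q′} → q ≋ q′ → p *P q ≋ p *P q′
*-congˡ [] q≋q′ = ≋-refl
*-congˡ (a ∷ p) q≋q′ = +-cong (scale-cong a q≋q′) (∷-cong refl (*-congˡ p q≋q′))

*-∷ʳ : ∀ p b q → p *P (b ∷ q) ≋ b ·P p +P (0ℤ ∷ p *P q)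
*-∷ʳ [] b q = mk≋ λ { zero → refl ; (suc i) → refl }
*-∷ʳ (a ∷ p) b q = mk≋ λ
  { zero → cong (ℤ._+ 0ℤ) (ℤₚ.*-comm a b)
  ; (suc i) → begin
      coeff (a ·P q +P p *P (b ∷ q)) i
        ≡⟨ trans (coeff-+ (a ·P q) (p *P (b ∷ q)) i) (cong₂ ℤ._+_ (coeff-scale a q i)
             (trans (coeff-≡ (*-∷ʳ p b q) i) (coeff-+ (b ·P p) _ i))) ⟩
      a ℤ.* coeff q i ℤ.+ (coeff (b ·P p) i ℤ.+ coeff (0ℤ ∷ p *P q) i)
        ≡⟨ x∙yz≈y∙xz (a ℤ.* coeff q i) (coeff (b ·P p) i) (coeff (0ℤ ∷ p *P q) i) ⟩
      coeff (b ·P p) i ℤ.+ (a ℤ.* coeff q i ℤ.+ coeff (0ℤ ∷ p *P q) i)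
        ≡⟨ sym (trans (coeff-+ (b ·P p) ((a ∷ p) *P q) i)
             (cong (ℤ._+_ (coeff (b ·P p) i)) (coeff-*-∷ a p q i))) ⟩
      coeff (b ·P p +P (a ∷ p) *P q) i ∎ }
  where
  open ≡-Reasoning
  open import Algebra.Properties.CommutativeSemigroup ℤₚ.+-commutativeSemigroup
    using (x∙yz≈y∙xz)

*-comm : ∀ p q → p *P q ≋ q *P p
*-comm [] q = ≋-sym (*-zeroʳ q)
*-comm (a ∷ p) q = ≋-sym (≋-trans (*-∷ʳ q a p) (+-cong ≋-refl (∷-cong refl (*-comm q p))))

*-congʳ : ∀ {p p′} q → p ≋ p′ → p *P q ≋ p′ *P q
*-congʳ {p} {p′} q p≋p′ = ≋-trans (*-comm p q) (≋-trans (*-congˡ q p≋p′) (*-comm q p′))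

*-cong : ∀ {p p′ q q′} → p ≋ p′ → q ≋ q′ → p *P q ≋ p′ *P q′
*-cong {p′ = p′} {q = q} p≋p′ q≋q′ = ≋-trans (*-congʳ q p≋p′) (*-congˡ p′ q≋q′)

*-distribˡ : ∀ p q r → p *P (q +P r) ≋ p *P q +P p *P r
*-distribˡ [] q r = ≋-refl
*-distribˡ (a ∷ p) q r = ≋-trans
  (+-cong (scale-distrib a q r) (∷-cong refl (*-distribˡ p q r)))
  (+-interchange (a ·P q) (a ·P r) (0ℤ ∷ p *P q) (0ℤ ∷ p *P r))

*-distribʳ : ∀ r p q → (p +P q) *P r ≋ p *P r +P q *P r
*-distribʳ r p q = ≋-trans (*-comm (p +P q) r)
  (≋-trans (*-distribˡ r p q) (+-cong (*-comm r p) (*-comm r q)))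

scale-* : ∀ a p q → (a ·P p) *P q ≋ a ·P (p *P q)
scale-* a [] q = ≋-refl
scale-* a (b ∷ p) q = begin
  (a ℤ.* b) ·P q +P (0ℤ ∷ (a ·P p) *P q)
    ≈⟨ +-cong (scale-scale a b q) (∷-cong refl (scale-* a p q)) ⟩
  a ·P (b ·P q) +P (0ℤ ∷ a ·P (p *P q))
    ≈⟨ +-cong ≋-refl (0∷-scale a (p *P q)) ⟩
  a ·P (b ·P q) +P a ·P (0ℤ ∷ p *P q)
    ≈⟨ ≋-sym (scale-distrib a (b ·P q) (0ℤ ∷ p *P q)) ⟩
  a ·P ((b ∷ p) *P q) ∎
  where open ≋-Reasoning

0∷-* : ∀ p q → (0ℤ ∷ p) *P q ≋ 0ℤ ∷ p *P q
0∷-* p q = +-cong (scale-zero q) ≋-refl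

*-assoc : ∀ p q r → (p *P q) *P r ≋ p *P (q *P r)
*-assoc [] q r = ≋-refl
*-assoc (a ∷ p) q r = begin
  (a ·P q +P (0ℤ ∷ p *P q)) *P r          ≈⟨ *-distribʳ r (a ·P q) (0ℤ ∷ p *P q) ⟩
  (a ·P q) *P r +P (0ℤ ∷ p *P q) *P r     ≈⟨ +-cong (scale-* a q r) (0∷-* (p *P q) r) ⟩
  a ·P (q *P r) +P (0ℤ ∷ (p *P q) *P r)   ≈⟨ +-cong ≋-refl (∷-cong refl (*-assoc p q r)) ⟩
  a ·P (q *P r) +P (0ℤ ∷ p *P (q *P r))   ∎
  where open ≋-Reasoning

*-identityˡ : ∀ p → oneP *P p ≋ p
*-identityˡ p = ≋-trans (+-cong (scale-one p) 0∷[]≋[]) (+-identityʳ p)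

ℤ[q] : CommutativeRing _ _
ℤ[q] = record
  { Carrier = Poly
  ; _≈_ = _≋_
  ; _+_ = _+P_
  ; _*_ = _*P_
  ; -_ = -P_
  ; 0# = []
  ; 1# = oneP
  ; isCommutativeRing = record
    { isRing = record
      { +-isAbelianGroup = record
        { isGroup = record
          { isMonoid = record
            { isSemigroup = record
              { isMagma = record { isEquivalence = ≋-isEquivalence ; ∙-cong = +-cong }
              ; assoc = +-assoc }
            ; identity = (λ p → ≋-refl) , +-identityʳ }
          ; inverse = -‿inverseˡ , -‿inverseʳ
          ; ⁻¹-cong = neg-cong }
        ; comm = +-comm }
      ; *-cong = *-cong
      ; *-assoc = *-assoc
      ; *-identity = *-identityˡ , λ p → ≋-trans (*-comm p oneP) (*-identityˡ p)
      ; distrib = *-distribˡ , *-distribʳ }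
    ; *-comm = *-comm }
  }

open CommutativeRing ℤ[q] using (+-group; commutativeSemiring; *-commutativeSemigroup)
open import Algebra.Properties.Group +-group using (x∙y⁻¹≈ε⇒x≈y; x≈y⇒x∙y⁻¹≈ε)
open import Algebra.Properties.CommutativeSemiring.Exp commutativeSemiring
  using (_^_; ^-assocʳ; ^-homo-*; ^-congʳ)
open import Algebra.Properties.CommutativeSemigroup.Divisibility *-commutativeSemigroup
  using (_∣_; _,_; ∣ʳ-trans; ∣ʳ-respˡ-≈; ∣ʳ-respʳ-≈; x∣ʳy⇒x∣ʳzy; ∙-cong-∣)

-- The solver only cancels a coefficient that this test recognises as zero.
[]≋? : ∀ p → Maybe ([] ≋ p)
[]≋? [] = just ≋-refl
[]≋? (a ∷ p) with a ℤ.≟ 0ℤ | []≋? p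
... | yes refl | just []≋p = just (mk≋ λ { zero → refl ; (suc i) → coeff-≡ []≋p i })
... | _        | _         = nothing

-- solve-∀ recognises the ring operations in their normal forms _+P_, _*P_, -P_, so the
-- identities handed to it are stated with the operations of Defs.
ℤ[q]-ACR : AlmostCommutativeRing _ _
ℤ[q]-ACR = fromCommutativeRing ℤ[q] []≋?

IsZeroP⇒≋[] : ∀ {p} → IsZeroP p → p ≋ []
IsZeroP⇒≋[] [] = ≋-refl
IsZeroP⇒≋[] (a≡0 ∷ p≡0) = mk≋ λ { zero → a≡0 ; (suc i) → coeff-≡ (IsZeroP⇒≋[] p≡0) i }

≋[]⇒IsZeroP : ∀ {p} → p ≋ [] → IsZeroP p
≋[]⇒IsZeroP {[]} _ = []
≋[]⇒IsZeroP {a ∷ p} (mk≋ e) = e zero ∷ ≋[]⇒IsZeroP (mk≋ (e ∘ suc))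

≈P⇒≋ : ∀ {p p′} → p ≈P p′ → p ≋ p′
≈P⇒≋ {p} {p′} = x∙y⁻¹≈ε⇒x≈y p p′ ∘ IsZeroP⇒≋[]

≋⇒≈P : ∀ {p p′} → p ≋ p′ → p ≈P p′
≋⇒≈P = ≋[]⇒IsZeroP ∘ x≈y⇒x∙y⁻¹≈ε

∣P⇒∣ : ∀ {c p} → c ∣P p → c ∣ p
∣P⇒∣ (t , e) = t , ≈P⇒≋ e

∣⇒∣P : ∀ {c p} → c ∣ p → c ∣P p
∣⇒∣P (t , e) = t , ≋⇒≈P e

-- Powers and geometric sums

q : Poly
q = 0ℤ ∷ 1ℤ ∷ []

qpow≋q^ : ∀ k → qpow k ≋ q ^ k
qpow≋q^ zero = ≋-refl
qpow≋q^ (suc k) = ≋-sym (≋-trans (0∷-* oneP (q ^ k))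
  (∷-cong refl (≋-trans (*-identityˡ (q ^ k)) (≋-sym (qpow≋q^ k)))))

1-qpow≋1-q^ : ∀ k → oneP -P qpow k ≋ oneP -P q ^ k
1-qpow≋1-q^ k = +-cong ≋-refl (neg-cong (qpow≋q^ k))

coeff₀-1-qpow : ∀ g → .{{ℕ.NonZero g}} → coeff (oneP -P qpow g) 0 ≡ 1ℤ
coeff₀-1-qpow (suc g) = refl

coeff₀-1-q^ : ∀ g → .{{ℕ.NonZero g}} → coeff (oneP -P q ^ g) 0 ≡ 1ℤ
coeff₀-1-q^ g = trans (sym (coeff-≡ (1-qpow≋1-q^ g) 0)) (coeff₀-1-qpow g)

geom : ℕ → Poly → Poly
geom zero w = []
geom (suc k) w = oneP +P w *P geom k w

geom-telescope : ∀ k w → (oneP -P w) *P geom k w ≋ oneP -P w ^ k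
geom-telescope zero w = ≋-trans (*-zeroʳ (oneP -P w)) (≋-sym (-‿inverseʳ oneP))
geom-telescope (suc k) w = begin
  (oneP -P w) *P (oneP +P w *P geom k w)          ≈⟨ expand w (geom k w) ⟩
  (oneP -P w) +P w *P ((oneP -P w) *P geom k w)   ≈⟨ +-cong ≋-refl (*-congˡ w (geom-telescope k w)) ⟩
  (oneP -P w) +P w *P (oneP -P w ^ k)             ≈⟨ collapse w (w ^ k) ⟩
  oneP -P w *P w ^ k                              ∎
  where
  open ≋-Reasoning
  expand : ∀ w G → (oneP -P w) *P (oneP +P w *P G) ≋ (oneP -P w) +P w *P ((oneP -P w) *P G)
  expand = solve-∀ ℤ[q]-ACR
  collapse : ∀ w P → (oneP -P w) +P w *P (oneP -P P) ≋ oneP -P w *P P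
  collapse = solve-∀ ℤ[q]-ACR

geom-telescope-^ : ∀ w g k → (oneP -P w ^ g) *P geom k (w ^ g) ≋ oneP -P w ^ (g ℕ.* k)
geom-telescope-^ w g k =
  ≋-trans (geom-telescope k (w ^ g)) (+-cong ≋-refl (neg-cong (^-assocʳ w g k)))

geom∣1-w^k : ∀ k w → geom k w ∣ oneP -P w ^ k
geom∣1-w^k k w = oneP -P w , geom-telescope k w

1-w^k∣1-w^s : ∀ w {k s} → k ∣ℕ s → oneP -P w ^ k ∣ oneP -P w ^ s
1-w^k∣1-w^s w {k} (divides t refl) = geom t (w ^ k) , (begin
  geom t (w ^ k) *P (oneP -P w ^ k)   ≈⟨ *-comm (geom t (w ^ k)) _ ⟩
  (oneP -P w ^ k) *P geom t (w ^ k)   ≈⟨ geom-telescope-^ w k t ⟩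
  oneP -P w ^ (k ℕ.* t)               ≈⟨ +-cong ≋-refl (neg-cong (^-congʳ w (ℕₚ.*-comm k t))) ⟩
  oneP -P w ^ (t ℕ.* k)               ∎)
  where open ≋-Reasoning

constP : ℤ → Poly
constP a = a ∷ []

1-w∣geom-k : ∀ k w → oneP -P w ∣ geom k w -P constP (+ k)
1-w∣geom-k zero w = [] , ≋-sym 0∷[]≋[]
1-w∣geom-k (suc k) w with 1-w∣geom-k k w
... | t , t*[1-w]≋G-K = t -P G , (begin
  (t -P G) *P (oneP -P w)                ≈⟨ distrib t G w ⟩
  t *P (oneP -P w) -P (oneP -P w) *P G   ≈⟨ +-cong t*[1-w]≋G-K ≋-refl ⟩
  (G -P K) -P (oneP -P w) *P G           ≈⟨ regroup G K w ⟩
  (oneP +P w *P G) -P (oneP +P K)        ∎)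
  where
  open ≋-Reasoning
  G K : Poly
  G = geom k w
  K = constP (+ k)
  distrib : ∀ t G w → (t -P G) *P (oneP -P w) ≋ t *P (oneP -P w) -P (oneP -P w) *P G
  distrib = solve-∀ ℤ[q]-ACR
  regroup : ∀ G K w → (G -P K) -P (oneP -P w) *P G ≋ (oneP +P w *P G) -P (oneP +P K)
  regroup = solve-∀ ℤ[q]-ACR

-- Coprimality over ℚ

infix 4 _∈⟨_,_⟩
record _∈⟨_,_⟩ (p F G : Poly) : Set where
  constructor combination
  field
    u v : Poly
    u*F+v*G≋p : u *P F +P v *P G ≋ p

module _ {F G : Poly} where

  ∈⟨⟩-resp-≋ : ∀ {p p′} → p ≋ p′ → p ∈⟨ F , G ⟩ → p′ ∈⟨ F , G ⟩
  ∈⟨⟩-resp-≋ p≋p′ (combination u v eq) = combination u v (≋-trans eq p≋p′)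

  F∈⟨F,G⟩ : F ∈⟨ F , G ⟩
  F∈⟨F,G⟩ = combination oneP [] (≋-trans (+-identityʳ (oneP *P F)) (*-identityˡ F))

  G∈⟨F,G⟩ : G ∈⟨ F , G ⟩
  G∈⟨F,G⟩ = combination [] oneP (*-identityˡ G)

  ∈⟨⟩-∣ : ∀ {p p′} → p ∈⟨ F , G ⟩ → p ∣ p′ → p′ ∈⟨ F , G ⟩
  ∈⟨⟩-∣ {p} {p′} (combination u v eq) (t , t*p≋p′) = combination (t *P u) (t *P v) (begin
    t *P u *P F +P t *P v *P G   ≈⟨ factor t u v F G ⟩
    t *P (u *P F +P v *P G)      ≈⟨ *-congˡ t eq ⟩
    t *P p                       ≈⟨ t*p≋p′ ⟩
    p′                           ∎)
    where
    open ≋-Reasoning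
    factor : ∀ t u v F G → t *P u *P F +P t *P v *P G ≋ t *P (u *P F +P v *P G)
    factor = solve-∀ ℤ[q]-ACR

  ∈⟨⟩-+ : ∀ {p p′} → p ∈⟨ F , G ⟩ → p′ ∈⟨ F , G ⟩ → p +P p′ ∈⟨ F , G ⟩
  ∈⟨⟩-+ {p} {p′} (combination u v eq) (combination u′ v′ eq′) =
    combination (u +P u′) (v +P v′) (begin
      (u +P u′) *P F +P (v +P v′) *P G              ≈⟨ regroup u u′ v v′ F G ⟩
      (u *P F +P v *P G) +P (u′ *P F +P v′ *P G)    ≈⟨ +-cong eq eq′ ⟩
      p +P p′                                       ∎)
    where
    open ≋-Reasoning
    regroup : ∀ u u′ v v′ F G →
      (u +P u′) *P F +P (v +P v′) *P G ≋ (u *P F +P v *P G) +P (u′ *P F +P v′ *P G)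
    regroup = solve-∀ ℤ[q]-ACR

  ∈⟨⟩-- : ∀ {p p′} → p ∈⟨ F , G ⟩ → p′ ∈⟨ F , G ⟩ → p -P p′ ∈⟨ F , G ⟩
  ∈⟨⟩-- {p} {p′} (combination u v eq) (combination u′ v′ eq′) =
    combination (u -P u′) (v -P v′) (begin
      (u -P u′) *P F +P (v -P v′) *P G              ≈⟨ regroup u u′ v v′ F G ⟩
      (u *P F +P v *P G) -P (u′ *P F +P v′ *P G)    ≈⟨ +-cong eq (neg-cong eq′) ⟩
      p -P p′                                       ∎)
    where
    open ≋-Reasoning
    regroup : ∀ u u′ v v′ F G →
      (u -P u′) *P F +P (v -P v′) *P G ≋ (u *P F +P v *P G) -P (u′ *P F +P v′ *P G)
    regroup = solve-∀ ℤ[q]-ACR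

∈⟨⟩-resp-generators : ∀ {p F F′ G G′} → F ≋ F′ → G ≋ G′ →
  p ∈⟨ F , G ⟩ → p ∈⟨ F′ , G′ ⟩
∈⟨⟩-resp-generators F≋F′ G≋G′ (combination u v eq) =
  combination u v (≋-trans (+-cong (*-congˡ u (≋-sym F≋F′)) (*-congˡ v (≋-sym G≋G′))) eq)

∈⟨⟩-* : ∀ {F₁ F₂ G p₁ p₂} → p₁ ∈⟨ F₁ , G ⟩ → p₂ ∈⟨ F₂ , G ⟩ →
  p₁ *P p₂ ∈⟨ F₁ *P F₂ , G ⟩
∈⟨⟩-* {F₁} {F₂} {G} {p₁} {p₂} (combination u₁ v₁ eq₁) (combination u₂ v₂ eq₂) =
  combination (u₁ *P u₂) (u₁ *P F₁ *P v₂ +P v₁ *P p₂) (begin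
    u₁ *P u₂ *P (F₁ *P F₂) +P (u₁ *P F₁ *P v₂ +P v₁ *P p₂) *P G
      ≈⟨ regroup u₁ u₂ v₁ v₂ F₁ F₂ G p₂ ⟩
    u₁ *P F₁ *P (u₂ *P F₂ +P v₂ *P G) +P v₁ *P G *P p₂
      ≈⟨ +-cong (*-congˡ (u₁ *P F₁) eq₂) ≋-refl ⟩
    u₁ *P F₁ *P p₂ +P v₁ *P G *P p₂
      ≈⟨ ≋-sym (*-distribʳ p₂ (u₁ *P F₁) (v₁ *P G)) ⟩
    (u₁ *P F₁ +P v₁ *P G) *P p₂
      ≈⟨ *-congʳ p₂ eq₁ ⟩
    p₁ *P p₂ ∎)
  where
  open ≋-Reasoning
  regroup : ∀ u₁ u₂ v₁ v₂ F₁ F₂ G p₂ →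
    u₁ *P u₂ *P (F₁ *P F₂) +P (u₁ *P F₁ *P v₂ +P v₁ *P p₂) *P G ≋
    u₁ *P F₁ *P (u₂ *P F₂ +P v₂ *P G) +P v₁ *P G *P p₂
  regroup = solve-∀ ℤ[q]-ACR

-- F and G are coprime in ℚ[q] iff clearing the denominators of a Bézout identity puts a
-- nonzero integer into the ideal they generate in ℤ[q].
CoprimeOverℚ : Poly → Poly → Set
CoprimeOverℚ F G = Σ[ M ∈ ℤ ] ℤ.NonZero M × constP M ∈⟨ F , G ⟩

CoprimeOverℚ-resp : ∀ {F F′ G G′} → F ≋ F′ → G ≋ G′ →
  CoprimeOverℚ F G → CoprimeOverℚ F′ G′
CoprimeOverℚ-resp F≋F′ G≋G′ (M , M≢0 , M∈) = M , M≢0 , ∈⟨⟩-resp-generators F≋F′ G≋G′ M∈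

1∈⟨⟩⇒CoprimeOverℚ : ∀ {F G} → oneP ∈⟨ F , G ⟩ → CoprimeOverℚ F G
1∈⟨⟩⇒CoprimeOverℚ 1∈ = 1ℤ , _ , 1∈

constP-* : ∀ a b → constP (a ℤ.* b) ≋ constP a *P constP b
constP-* a b = ∷-cong (sym (ℤₚ.+-identityʳ _)) ≋-refl

CoprimeOverℚ-* : ∀ {F₁ F₂ G} → CoprimeOverℚ F₁ G → CoprimeOverℚ F₂ G →
  CoprimeOverℚ (F₁ *P F₂) G
CoprimeOverℚ-* (M₁ , M₁≢0 , M₁∈) (M₂ , M₂≢0 , M₂∈) =
  M₁ ℤ.* M₂ , ℤₚ.i*j≢0 M₁ M₂ {{M₁≢0}} {{M₂≢0}} ,
  ∈⟨⟩-resp-≋ (≋-sym (constP-* M₁ M₂)) (∈⟨⟩-* M₁∈ M₂∈)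

1-w∈⟨⟩-consecutive : ∀ {F G} w s →
  oneP -P w ^ s ∈⟨ F , G ⟩ → oneP -P w ^ suc s ∈⟨ F , G ⟩ → oneP -P w ∈⟨ F , G ⟩
1-w∈⟨⟩-consecutive w s s∈ suc-s∈ =
  ∈⟨⟩-resp-≋ (telescope w (w ^ s)) (∈⟨⟩-- suc-s∈ (∈⟨⟩-∣ s∈ (w , ≋-refl)))
  where
  telescope : ∀ w P → (oneP -P w *P P) -P w *P (oneP -P P) ≋ oneP -P w
  telescope = solve-∀ ℤ[q]-ACR

module _ (w : Poly) {k h : ℕ} where

  1-w^s∈⟨geom,1-w^h⟩ˡ : ∀ {s} → k ∣ℕ s → oneP -P w ^ s ∈⟨ geom k w , oneP -P w ^ h ⟩
  1-w^s∈⟨geom,1-w^h⟩ˡ k∣s =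
    ∈⟨⟩-∣ F∈⟨F,G⟩ (∣ʳ-trans (geom∣1-w^k k w) (1-w^k∣1-w^s w k∣s))

  1-w^s∈⟨geom,1-w^h⟩ʳ : ∀ {s} → h ∣ℕ s → oneP -P w ^ s ∈⟨ geom k w , oneP -P w ^ h ⟩
  1-w^s∈⟨geom,1-w^h⟩ʳ h∣s = ∈⟨⟩-∣ G∈⟨F,G⟩ (1-w^k∣1-w^s w h∣s)

  1-w∈⟨geom,1-w^h⟩ : Bézout.Identity 1 k h → oneP -P w ∈⟨ geom k w , oneP -P w ^ h ⟩
  1-w∈⟨geom,1-w^h⟩ (Bézout.+- x y 1+yh≡xk) = 1-w∈⟨⟩-consecutive w (y ℕ.* h)
    (1-w^s∈⟨geom,1-w^h⟩ʳ (divides y refl)) (1-w^s∈⟨geom,1-w^h⟩ˡ (divides x 1+yh≡xk))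
  1-w∈⟨geom,1-w^h⟩ (Bézout.-+ x y 1+xk≡yh) = 1-w∈⟨⟩-consecutive w (x ℕ.* k)
    (1-w^s∈⟨geom,1-w^h⟩ˡ (divides x refl)) (1-w^s∈⟨geom,1-w^h⟩ʳ (divides y 1+xk≡yh))

  geom-CoprimeOverℚ : {{k≢0 : ℕ.NonZero k}} → Bézout.Identity 1 k h →
    CoprimeOverℚ (geom k w) (oneP -P w ^ h)
  geom-CoprimeOverℚ {{k≢0}} bézout = + k , k≢0 , ∈⟨⟩-resp-≋ (cancel (geom k w) (constP (+ k)))
    (∈⟨⟩-- F∈⟨F,G⟩ (∈⟨⟩-∣ (1-w∈⟨geom,1-w^h⟩ bézout) (1-w∣geom-k k w)))
    where
    cancel : ∀ G K → G -P (G -P K) ≋ K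
    cancel = solve-∀ ℤ[q]-ACR

1∈⟨w^a,1-w^n⟩ : ∀ w a n → .{{ℕ.NonZero n}} → oneP ∈⟨ w ^ a , oneP -P w ^ n ⟩
1∈⟨w^a,1-w^n⟩ w a (suc n) = ∈⟨⟩-resp-≋ (split (w ^ (a ℕ.* suc n)))
  (∈⟨⟩-+ (∈⟨⟩-∣ F∈⟨F,G⟩ w^a∣w^[a*[1+n]])
         (∈⟨⟩-∣ G∈⟨F,G⟩ (1-w^k∣1-w^s w (divides a refl))))
  where
  w^a∣w^[a*[1+n]] : w ^ a ∣ w ^ (a ℕ.* suc n)
  w^a∣w^[a*[1+n]] = w ^ (a ℕ.* n) , ≋-sym (≋-trans (^-congʳ w (ℕₚ.*-suc a n))
    (≋-trans (^-homo-* w a (a ℕ.* n)) (*-comm (w ^ a) _)))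
  split : ∀ P → P +P (oneP -P P) ≋ oneP
  split = solve-∀ ℤ[q]-ACR

-- Cancellation in ℤ[q]

coeff-constP-* : ∀ a p i → coeff (constP a *P p) i ≡ a ℤ.* coeff p i
coeff-constP-* a p i =
  trans (coeff-≡ (≋-trans (+-cong ≋-refl 0∷[]≋[]) (+-identityʳ (a ·P p))) i) (coeff-scale a p i)

∣ℤ-coeffs-cancelʳ : ∀ {M G} h → coeff G 0 ≡ 1ℤ →
  (∀ i → M ∣ℤ coeff (h *P G) i) → ∀ i → M ∣ℤ coeff h i
∣ℤ-coeffs-cancelʳ [] G₀≡1 M∣hG i = divides 0ℤ refl
∣ℤ-coeffs-cancelʳ {M} {G} (a ∷ h) G₀≡1 M∣hG = M∣coeff
  where
  M∣a : M ∣ℤ a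
  M∣a = subst (M ∣ℤ_) (trans (coeff-*-∷ a h G 0)
    (trans (ℤₚ.+-identityʳ _) (trans (cong (a ℤ.*_) G₀≡1) (ℤₚ.*-identityʳ a)))) (M∣hG 0)
  M∣hG′ : ∀ j → M ∣ℤ coeff (h *P G) j
  M∣hG′ j = ∣m+n∣m⇒∣n (subst (M ∣ℤ_) (coeff-*-∷ a h G (suc j)) (M∣hG (suc j)))
    (∣m⇒∣m*n (coeff G (suc j)) M∣a)
  M∣coeff : ∀ i → M ∣ℤ coeff (a ∷ h) i
  M∣coeff zero = M∣a
  M∣coeff (suc i) = ∣ℤ-coeffs-cancelʳ h G₀≡1 M∣hG′ i

*-cancelʳ-≋ : ∀ {P Q E} → coeff E 0 ≡ 1ℤ → P *P E ≋ Q *P E → P ≋ Q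
*-cancelʳ-≋ {P} {Q} {E} E₀≡1 PE≋QE = x∙y⁻¹≈ε⇒x≈y P Q (mk≋ λ i →
  0∣⇒≡0 (∣ℤ-coeffs-cancelʳ (P -P Q) E₀≡1 (λ j → divides 0ℤ (coeff-≡ [P-Q]E≋[] j)) i))
  where
  open ≋-Reasoning
  [P-Q]E≋[] : (P -P Q) *P E ≋ []
  [P-Q]E≋[] = begin
    (P -P Q) *P E      ≈⟨ distrib P Q E ⟩
    P *P E -P Q *P E   ≈⟨ +-cong PE≋QE ≋-refl ⟩
    Q *P E -P Q *P E   ≈⟨ -‿inverseʳ (Q *P E) ⟩
    []                 ∎
    where
    distrib : ∀ P Q E → (P -P Q) *P E ≋ P *P E -P Q *P E
    distrib = solve-∀ ℤ[q]-ACR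

constP-∣ : ∀ {M} h → (∀ i → M ∣ℤ coeff h i) → constP M ∣ h
constP-∣ [] M∣h = [] , ≋-refl
constP-∣ {M} (a ∷ h) M∣h with constP-∣ h (M∣h ∘ suc)
... | t , t*M≋h = quotient (M∣h 0) ∷ t ,
  ∷-cong (trans (ℤₚ.+-identityʳ _) (sym (_∣ℤ_.equality (M∣h 0)))) t*M≋h

constP-*-cancelˡ : ∀ {M P Q} → ℤ.NonZero M → constP M *P P ≋ constP M *P Q → P ≋ Q
constP-*-cancelˡ {M} {P} {Q} M≢0 MP≋MQ = mk≋ λ i →
  ℤₚ.*-cancelˡ-≡ M (coeff P i) (coeff Q i) {{M≢0}}
    (trans (sym (coeff-constP-* M P i)) (trans (coeff-≡ MP≋MQ i) (coeff-constP-* M Q i)))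

-- With M = uF + vG one gets M·A = H·c; as c ∣ G and G has constant term 1, M divides
-- every coefficient of H, and A = (H / M)·c.
∣-cancel-CoprimeOverℚ : ∀ {F G c A} → coeff G 0 ≡ 1ℤ → CoprimeOverℚ F G →
  c ∣ G → c ∣ A *P F → c ∣ A
∣-cancel-CoprimeOverℚ {F} {G} {c} {A} G₀≡1 (M , M≢0 , combination u v uF+vG≋M)
  (e , e*c≋G) (h , h*c≋AF) = divide-by-M (constP-∣ H M∣H)
  where
  open ≋-Reasoning
  H : Poly
  H = u *P h +P v *P A *P e
  M*A≋H*c : constP M *P A ≋ H *P c
  M*A≋H*c = begin
    constP M *P A                         ≈⟨ *-congʳ A (≋-sym uF+vG≋M) ⟩
    (u *P F +P v *P G) *P A               ≈⟨ expand u v F G A ⟩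
    u *P (A *P F) +P v *P A *P G
      ≈⟨ +-cong (*-congˡ u (≋-sym h*c≋AF)) (*-congˡ (v *P A) (≋-sym e*c≋G)) ⟩
    u *P (h *P c) +P v *P A *P (e *P c)   ≈⟨ collect u h c v A e ⟩
    H *P c                                ∎
    where
    expand : ∀ u v F G A → (u *P F +P v *P G) *P A ≋ u *P (A *P F) +P v *P A *P G
    expand = solve-∀ ℤ[q]-ACR
    collect : ∀ u h c v A e →
      u *P (h *P c) +P v *P A *P (e *P c) ≋ (u *P h +P v *P A *P e) *P c
    collect = solve-∀ ℤ[q]-ACR
  M*Ae≋H*G : constP M *P (A *P e) ≋ H *P G
  M*Ae≋H*G = begin
    constP M *P (A *P e)   ≈⟨ ≋-sym (*-assoc (constP M) A e) ⟩
    constP M *P A *P e     ≈⟨ *-congʳ e M*A≋H*c ⟩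
    H *P c *P e            ≈⟨ *-assoc H c e ⟩
    H *P (c *P e)          ≈⟨ *-congˡ H (≋-trans (*-comm c e) e*c≋G) ⟩
    H *P G                 ∎
  M∣H : ∀ i → M ∣ℤ coeff H i
  M∣H = ∣ℤ-coeffs-cancelʳ H G₀≡1 λ i → divides (coeff (A *P e) i)
    (trans (sym (coeff-≡ M*Ae≋H*G i)) (trans (coeff-constP-* M (A *P e) i) (ℤₚ.*-comm M _)))
  divide-by-M : constP M ∣ H → c ∣ A
  divide-by-M (H′ , H′*M≋H) = H′ , constP-*-cancelˡ M≢0 (begin
    constP M *P (H′ *P c)   ≈⟨ rotate (constP M) H′ c ⟩
    (H′ *P constP M) *P c   ≈⟨ *-congʳ c H′*M≋H ⟩
    H *P c                  ≈⟨ ≋-sym M*A≋H*c ⟩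
    constP M *P A           ∎)
    where
    rotate : ∀ x y z → x *P (y *P z) ≋ (y *P x) *P z
    rotate = solve-∀ ℤ[q]-ACR

coeff₀-* : ∀ p p′ → coeff (p *P p′) 0 ≡ coeff p 0 ℤ.* coeff p′ 0
coeff₀-* [] p′ = refl
coeff₀-* (a ∷ p) p′ = trans (coeff-*-∷ a p p′ 0) (ℤₚ.+-identityʳ _)

∣-cancel-common-factor : ∀ {A B D N₁ N₂ Qn Qd E F} → coeff E 0 ≡ 1ℤ →
  A *P (D *P (Qn *P Qn)) ≋ B *P (N₁ *P N₂ *P (Qd *P Qd)) →
  Qn ≋ E *P F → E ∣ N₁ → E ∣ N₂ → B ∣ A *P (D *P (F *P F))
∣-cancel-common-factor {A} {B} {D} {N₁} {N₂} {Qn} {Qd} {E} {F} E₀≡1 A/B≡ Qn≋EF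
  (Y₁ , Y₁E≋N₁) (Y₂ , Y₂E≋N₂) = Y₁ *P Y₂ *P (Qd *P Qd) ,
  *-cancelʳ-≋ (trans (coeff₀-* E E) (cong₂ ℤ._*_ E₀≡1 E₀≡1)) (begin
    Y₁ *P Y₂ *P (Qd *P Qd) *P B *P (E *P E)       ≈⟨ regroup-B Y₁ Y₂ Qd B E ⟩
    B *P ((Y₁ *P E) *P (Y₂ *P E) *P (Qd *P Qd))
      ≈⟨ *-congˡ B (*-congʳ (Qd *P Qd) (*-cong Y₁E≋N₁ Y₂E≋N₂)) ⟩
    B *P (N₁ *P N₂ *P (Qd *P Qd))                 ≈⟨ ≋-sym A/B≡ ⟩
    A *P (D *P (Qn *P Qn))                        ≈⟨ *-congˡ A (*-congˡ D (*-cong Qn≋EF Qn≋EF)) ⟩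
    A *P (D *P ((E *P F) *P (E *P F)))            ≈⟨ regroup-A A D E F ⟩
    A *P (D *P (F *P F)) *P (E *P E)              ∎)
  where
  open ≋-Reasoning
  regroup-B : ∀ Y₁ Y₂ Q B E →
    Y₁ *P Y₂ *P (Q *P Q) *P B *P (E *P E) ≋ B *P ((Y₁ *P E) *P (Y₂ *P E) *P (Q *P Q))
  regroup-B = solve-∀ ℤ[q]-ACR
  regroup-A : ∀ A D E F → A *P (D *P ((E *P F) *P (E *P F))) ≋ A *P (D *P (F *P F)) *P (E *P E)
  regroup-A = solve-∀ ℤ[q]-ACR

reduced-denominator-coprime : ∀ {A B G I} → CoprimeP A B → B ∣ A *P G →
  coeff I 0 ≡ 1ℤ → CoprimeOverℚ G I → CoprimeP B I
reduced-denominator-coprime {A} {B} {G} A⊥B B∣AG I₀≡1 G⊥I c c∣B c∣I =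
  A⊥B c (∣⇒∣P (∣-cancel-CoprimeOverℚ I₀≡1 G⊥I (∣P⇒∣ c∣I) c∣AG)) c∣B
  where
  c∣AG : c ∣ A *P G
  c∣AG = ∣ʳ-trans (∣P⇒∣ c∣B) B∣AG

-- Finite products and q-Pochhammer symbols

prod : (ℕ → Poly) → ℕ → Poly
prod f zero = oneP
prod f (suc m) = prod f m *P f m

prod-cong : ∀ {f g} m → (∀ j → f j ≋ g j) → prod f m ≋ prod g m
prod-cong zero f≋g = ≋-refl
prod-cong (suc m) f≋g = *-cong (prod-cong m f≋g) (f≋g m)

prod-* : ∀ f g m → prod (λ j → f j *P g j) m ≋ prod f m *P prod g m
prod-* f g zero = ≋-sym (*-identityˡ oneP)
prod-* f g (suc m) =
  ≋-trans (*-congʳ (f m *P g m) (prod-* f g m)) (interchange (prod f m) (prod g m) (f m) (g m))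
  where
  interchange : ∀ P Q x y → (P *P Q) *P (x *P y) ≋ (P *P x) *P (Q *P y)
  interchange = solve-∀ ℤ[q]-ACR

prod-shift : ∀ f m → prod f (suc m) ≋ f 0 *P prod (f ∘ suc) m
prod-shift f zero = *-comm oneP (f 0)
prod-shift f (suc m) =
  ≋-trans (*-congʳ (f (suc m)) (prod-shift f m)) (*-assoc (f 0) _ (f (suc m)))

prod-reverse : ∀ f m → prod f m ≋ prod (λ j → f (m ∸ suc j)) m
prod-reverse f zero = ≋-refl
prod-reverse f (suc m) = begin
  prod f m *P f m                       ≈⟨ *-congʳ (f m) (prod-reverse f m) ⟩
  prod (λ j → f (m ∸ suc j)) m *P f m   ≈⟨ *-comm _ (f m) ⟩
  f m *P prod (λ j → f (m ∸ suc j)) m   ≈⟨ ≋-sym (prod-shift (λ j → f (m ∸ j)) m) ⟩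
  prod (λ j → f (m ∸ j)) (suc m)        ∎
  where open ≋-Reasoning

prod-∣ : ∀ {e f} m → (∀ j → j < m → e j ∣ f j) → prod e m ∣ prod f m
prod-∣ zero e∣f = oneP , *-identityˡ oneP
prod-∣ (suc m) e∣f =
  ∙-cong-∣ (prod-∣ m λ j j<m → e∣f j (ℕₚ.m<n⇒m<1+n j<m)) (e∣f m ℕₚ.≤-refl)

coeff₀-prod : ∀ f m → (∀ j → coeff (f j) 0 ≡ 1ℤ) → coeff (prod f m) 0 ≡ 1ℤ
coeff₀-prod f zero f₀≡1 = refl
coeff₀-prod f (suc m) f₀≡1 =
  trans (coeff₀-* (prod f m) (f m)) (cong₂ ℤ._*_ (coeff₀-prod f m f₀≡1) (f₀≡1 m))

CoprimeOverℚ-prod : ∀ {G} f m → (∀ j → CoprimeOverℚ (f j) G) → CoprimeOverℚ (prod f m) G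
CoprimeOverℚ-prod f zero f⊥G = 1∈⟨⟩⇒CoprimeOverℚ F∈⟨F,G⟩
CoprimeOverℚ-prod f (suc m) f⊥G = CoprimeOverℚ-* (CoprimeOverℚ-prod f m f⊥G) (f⊥G m)

numerator denominator : RatF → Poly
numerator = proj₁
denominator = proj₂

poch-numerator : ∀ a d m →
  numerator (poch a d m) ≡ prod (λ j → numerator (oneMinusQ (a ℤ.+ + j ℤ.* d))) m
poch-numerator a d zero = refl
poch-numerator a d (suc m) =
  cong (_*P numerator (oneMinusQ (a ℤ.+ + m ℤ.* d))) (poch-numerator a d m)

poch-denominator : ∀ a d m →
  denominator (poch a d m) ≡ prod (λ j → denominator (oneMinusQ (a ℤ.+ + j ℤ.* d))) m
poch-denominator a d zero = refl
poch-denominator a d (suc m) =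
  cong (_*P denominator (oneMinusQ (a ℤ.+ + m ℤ.* d))) (poch-denominator a d m)

1-q^g∣numerator-oneMinusQ : ∀ {g} e → + g ∣ℤ e → oneP -P q ^ g ∣ numerator (oneMinusQ e)
1-q^g∣numerator-oneMinusQ (+ s) g∣e =
  ∣ʳ-respʳ-≈ (≋-sym (1-qpow≋1-q^ s)) (1-w^k∣1-w^s q (∣⇒∣ᵤ g∣e))
1-q^g∣numerator-oneMinusQ -[1+ s ] g∣e =
  ∣ʳ-respʳ-≈ (≋-trans (negate (q ^ suc s)) (+-cong (≋-sym (qpow≋q^ (suc s))) ≋-refl))
    (x∣ʳy⇒x∣ʳzy (-P oneP) (1-w^k∣1-w^s q (∣⇒∣ᵤ g∣e)))
  where
  negate : ∀ P → (-P oneP) *P (oneP -P P) ≋ P -P oneP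
  negate = solve-∀ ℤ[q]-ACR

denominator-oneMinusQ-CoprimeOverℚ : ∀ e n → .{{ℕ.NonZero n}} →
  CoprimeOverℚ (denominator (oneMinusQ e)) (oneP -P qpow n)
denominator-oneMinusQ-CoprimeOverℚ (+ s) n = 1∈⟨⟩⇒CoprimeOverℚ F∈⟨F,G⟩
denominator-oneMinusQ-CoprimeOverℚ -[1+ s ] n =
  CoprimeOverℚ-resp (≋-sym (qpow≋q^ (suc s))) (≋-sym (1-qpow≋1-q^ n))
    (1∈⟨⟩⇒CoprimeOverℚ (1∈⟨w^a,1-w^n⟩ q (suc s) n))

denominator-poch-CoprimeOverℚ : ∀ a d m n → .{{ℕ.NonZero n}} →
  CoprimeOverℚ (denominator (poch a d m)) (oneP -P qpow n)
denominator-poch-CoprimeOverℚ a d m n =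
  subst (λ D → CoprimeOverℚ D _) (sym (poch-denominator a d m))
    (CoprimeOverℚ-prod _ m λ j → denominator-oneMinusQ-CoprimeOverℚ (a ℤ.+ + j ℤ.* d) n)

pos-suc-* : ∀ j d → + (suc j ℕ.* d) ≡ + d ℤ.+ + j ℤ.* + d
pos-suc-* j d = trans (ℤₚ.pos-+ d (j ℕ.* d)) (cong (ℤ._+_ (+ d)) (ℤₚ.pos-* j d))

index-below : ∀ r d {m j} → j < m →
  (+ m ℤ.* + d ℤ.+ r) ℤ.- + (suc (m ∸ suc j) ℕ.* d) ≡ r ℤ.+ + j ℤ.* + d
index-below r d {m} {j} j<m = begin
  (+ m ℤ.* + d ℤ.+ r) ℤ.- + (suc k ℕ.* d)
    ≡⟨ cong₂ (λ x y → (x ℤ.* + d ℤ.+ r) ℤ.- y) +m≡1+j+k (pos-suc-* k d) ⟩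
  ((1ℤ ℤ.+ + j ℤ.+ + k) ℤ.* + d ℤ.+ r) ℤ.- (+ d ℤ.+ + k ℤ.* + d)
    ≡⟨ cancel r (+ d) (+ j) (+ k) ⟩
  r ℤ.+ + j ℤ.* + d ∎
  where
  open ≡-Reasoning
  k : ℕ
  k = m ∸ suc j
  +m≡1+j+k : + m ≡ 1ℤ ℤ.+ + j ℤ.+ + k
  +m≡1+j+k = trans (cong +_ (sym (ℕₚ.m+[n∸m]≡n j<m))) (ℤₚ.pos-+ (suc j) k)
  cancel : ∀ r d j k →
    ((1ℤ ℤ.+ j ℤ.+ k) ℤ.* d ℤ.+ r) ℤ.- (d ℤ.+ k ℤ.* d) ≡ r ℤ.+ j ℤ.* d
  cancel = ℤ-Solver.solve-∀

index-above : ∀ r d m j →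
  (+ m ℤ.* + d ℤ.+ r) ℤ.+ + (suc j ℕ.* d) ≡ r ℤ.+ + (m ℕ.+ 1) ℤ.* + d ℤ.+ + j ℤ.* + d
index-above r d m j = begin
  (+ m ℤ.* + d ℤ.+ r) ℤ.+ + (suc j ℕ.* d)
    ≡⟨ cong (ℤ._+_ (+ m ℤ.* + d ℤ.+ r)) (pos-suc-* j d) ⟩
  (+ m ℤ.* + d ℤ.+ r) ℤ.+ (+ d ℤ.+ + j ℤ.* + d)
    ≡⟨ regroup r (+ d) (+ m) (+ j) ⟩
  r ℤ.+ (+ m ℤ.+ 1ℤ) ℤ.* + d ℤ.+ + j ℤ.* + d
    ≡⟨ cong (λ x → r ℤ.+ x ℤ.* + d ℤ.+ + j ℤ.* + d) (sym (ℤₚ.pos-+ m 1)) ⟩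
  r ℤ.+ + (m ℕ.+ 1) ℤ.* + d ℤ.+ + j ℤ.* + d ∎
  where
  open ≡-Reasoning
  regroup : ∀ r d m j →
    (m ℤ.* d ℤ.+ r) ℤ.+ (d ℤ.+ j ℤ.* d) ≡ r ℤ.+ (m ℤ.+ 1ℤ) ℤ.* d ℤ.+ j ℤ.* d
  regroup = ℤ-Solver.solve-∀

module PochhammerFactors (n d : ℕ) .{{_ : ℕ.NonZero n}} .{{_ : ℕ.NonZero d}} where

  a g : ℕ → ℕ
  a j = suc j ℕ.* d
  g j = NG.gcd (a j) n

  g≢0 : ∀ j → ℕ.NonZero (g j)
  g≢0 j = ℕ.≢-nonZero (NG.gcd[m,n]≢0 (a j) n (inj₂ (ℕ.≢-nonZero⁻¹ n)))

  E F : ℕ → Poly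
  E j = oneP -P q ^ g j
  F j = geom ((a j / g j) {{g≢0 j}}) (q ^ g j)

  coeff₀-E : ∀ j → coeff (E j) 0 ≡ 1ℤ
  coeff₀-E j = coeff₀-1-q^ (g j) {{g≢0 j}}

  module _ (j : ℕ) where
    private instance
      g[j]≢0 : ℕ.NonZero (g j)
      g[j]≢0 = g≢0 j
      a[j]≢0 : ℕ.NonZero (a j)
      a[j]≢0 = ℕₚ.m*n≢0 (suc j) d

    numerator-factor : numerator (oneMinusQ (+ d ℤ.+ + j ℤ.* + d)) ≋ E j *P F j
    numerator-factor = begin
      numerator (oneMinusQ (+ d ℤ.+ + j ℤ.* + d))
        ≡⟨ cong (numerator ∘ oneMinusQ) (sym (pos-suc-* j d)) ⟩
      oneP -P qpow (a j)
        ≈⟨ 1-qpow≋1-q^ (a j) ⟩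
      oneP -P q ^ a j
        ≡⟨ cong (λ x → oneP -P q ^ x) (sym (m*[n/m]≡n (NG.gcd[m,n]∣m (a j) n))) ⟩
      oneP -P q ^ (g j ℕ.* (a j / g j))
        ≈⟨ ≋-sym (geom-telescope-^ q (g j) (a j / g j)) ⟩
      E j *P F j ∎
      where open ≋-Reasoning

    F-CoprimeOverℚ : CoprimeOverℚ (F j) (oneP -P qpow n)
    F-CoprimeOverℚ = CoprimeOverℚ-resp ≋-refl 1-[q^g]^[n/g]≋1-qⁿ
      (geom-CoprimeOverℚ (q ^ g j) {{ℕ.≢-nonZero (NG.m/gcd[m,n]≢0 (a j) n)}}
        (coprime-Bézout (coprime-/gcd (a j) n)))
      where
      1-[q^g]^[n/g]≋1-qⁿ : oneP -P (q ^ g j) ^ (n / g j) ≋ oneP -P qpow n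
      1-[q^g]^[n/g]≋1-qⁿ = +-cong ≋-refl (neg-cong (≋-trans (^-assocʳ q (g j) (n / g j))
        (≋-trans (^-congʳ q (m*[n/m]≡n (NG.gcd[m,n]∣n (a j) n))) (≋-sym (qpow≋q^ n)))))

    module _ {N : ℤ} (n∣N : + n ∣ℤ N) where

      g∣N : + g j ∣ℤ N
      g∣N = ℤ∣-trans (∣ᵤ⇒∣ (NG.gcd[m,n]∣n (a j) n)) n∣N

      g∣a : + g j ∣ℤ + a j
      g∣a = ∣ᵤ⇒∣ (NG.gcd[m,n]∣m (a j) n)

      E∣numerator-N+a : E j ∣ numerator (oneMinusQ (N ℤ.+ + a j))
      E∣numerator-N+a = 1-q^g∣numerator-oneMinusQ _ (∣m∣n⇒∣m+n g∣N g∣a)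

      E∣numerator-N-a : E j ∣ numerator (oneMinusQ (N ℤ.- + a j))
      E∣numerator-N-a = 1-q^g∣numerator-oneMinusQ _ (∣m∣n⇒∣m-n g∣N g∣a)

  numerator-poch-d : ∀ m → numerator (poch (+ d) (+ d) m) ≋ prod E m *P prod F m
  numerator-poch-d m = ≋-trans (≋-reflexive (poch-numerator (+ d) (+ d) m))
    (≋-trans (prod-cong m numerator-factor) (prod-* E F m))

  module _ (r : ℤ) (m : ℕ) (n∣N : + n ∣ℤ (+ m ℤ.* + d ℤ.+ r)) where

    prod-E∣numerator-poch-r : prod E m ∣ numerator (poch r (+ d) m)
    prod-E∣numerator-poch-r = subst (prod E m ∣_) (sym (poch-numerator r (+ d) m))
      (∣ʳ-respˡ-≈ (≋-sym (prod-reverse E m)) (prod-∣ m λ j j<m →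
        subst (λ e → E (m ∸ suc j) ∣ numerator (oneMinusQ e)) (index-below r d j<m)
          (E∣numerator-N-a (m ∸ suc j) n∣N)))

    prod-E∣numerator-poch-r+[m+1]d :
      prod E m ∣ numerator (poch (r ℤ.+ + (m ℕ.+ 1) ℤ.* + d) (+ d) m)
    prod-E∣numerator-poch-r+[m+1]d = subst (prod E m ∣_) (sym (poch-numerator _ (+ d) m))
      (prod-∣ m λ j _ → subst (λ e → E j ∣ numerator (oneMinusQ e)) (index-above r d m j)
        (E∣numerator-N+a j n∣N))

lemma2p5 : (n d : ℕ) → 0 < n → 0 < d → NG.gcd n d ≡ 1 →
    (r : ℤ) → IG.gcd r (+ d) ≡ ℤ.1ℤ →
    (m : ℕ) → m < n → (+ n) ID.∣ ((+ m) ℤ.* (+ d) ℤ.+ r) →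
    (A B : Poly) → CoprimeP A B →
    (A , B) ≡R ((poch r (+ d) m *R poch (r ℤ.+ (+ (m ℕ.+ 1)) ℤ.* (+ d)) (+ d) m)
                 /R (poch (+ d) (+ d) m *R poch (+ d) (+ d) m)) →
    CoprimeP B (oneP -P qpow n)
lemma2p5 n d 0<n 0<d _ r _ m _ n∣md+r A B A⊥B A/B≡ =
  reduced-denominator-coprime A⊥B
    (∣-cancel-common-factor {A} {B} {denominator P₁ *P denominator P₂} {Qd = denominator Q}
      (coeff₀-prod E m coeff₀-E) (≈P⇒≋ A/B≡) (numerator-poch-d m)
      (prod-E∣numerator-poch-r r m n∣N) (prod-E∣numerator-poch-r+[m+1]d r m n∣N))
    (coeff₀-1-qpow n)
    (CoprimeOverℚ-*
      (CoprimeOverℚ-* (denominator-poch-CoprimeOverℚ _ _ m n) (denominator-poch-CoprimeOverℚ _ _ m n))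
      (CoprimeOverℚ-* Fₘ⊥1-qⁿ Fₘ⊥1-qⁿ))
  where
  instance
    n≢0 : ℕ.NonZero n
    n≢0 = ℕ.>-nonZero 0<n
    d≢0 : ℕ.NonZero d
    d≢0 = ℕ.>-nonZero 0<d
  open PochhammerFactors n d
  n∣N : + n ∣ℤ (+ m ℤ.* + d ℤ.+ r)
  n∣N = ∣ᵤ⇒∣ n∣md+r
  P₁ P₂ Q : RatF
  P₁ = poch r (+ d) m
  P₂ = poch (r ℤ.+ + (m ℕ.+ 1) ℤ.* + d) (+ d) m
  Q = poch (+ d) (+ d) m
  Fₘ⊥1-qⁿ : CoprimeOverℚ (prod F m) (oneP -P qpow n)
  Fₘ⊥1-qⁿ = CoprimeOverℚ-prod F m F-CoprimeOverℚ
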